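{- Let $G$ be an arbitrarily partitionable (in particular, any recursively partitionable) graph, let $S\subseteq V(G)$, and let $k\ge2$ be an integer. Then \[|S|+\frac{|V(G)|_k}{k-1}\geq w_k(G,S).\]
   Context: For a finite set $X$ and integer $k\ge2$, $|X|_k$ denotes the unique $j\in\{0,\dots,k-1\}$ with $|X|\equiv j\pmod k$. For $S\subseteq V(G)$, $w_k(G,S)=\frac{1}{k-1}\sum\{|V(C)|_k : C \text{ a component of } G-S\}$. A graph $G$ on $n$ vertices is arbitrarily partitionable (AP) if for every integer partition $a_1,\dots,a_m$ of $n$ there is a partition $\{A_1,\dots,A_m\}$ of $V(G)$ with $|A_i|=a_i$ and each $G[A_i]$ connected. $G$ is recursively partitionable (RP) if $G\simeq K_1$, or $G$ is connected and for every integer partition $a_1,\dots,a_m$ of $n$ there is such a partition with each induced subgraph $G[A_i]$ RP. -}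

module Defs where

open import Data.Nat using (ℕ; _+_; _*_; _%_; _≤_; _≥_; _∸_; NonZero)
open import Data.Fin using (Fin)
open import Data.Fin.Properties using (_≟_)
open import Data.Fin.Subset using (Subset; _∈_; _∉_; ∣_∣; Nonempty)
open import Data.Vec using (Vec; lookup; tabulate; map; sum)
open import Data.Product using (Σ; _×_; _,_)
open import Relation.Nullary using (¬_)
open import Relation.Nullary.Decidable using (⌊_⌋)
import Relation.Binary.PropositionalEquality as Eq

record Graph (n : ℕ) : Set₁ where
  field
    Adj     : Fin n → Fin n → Set
    sym     : ∀ {u v} → Adj u v → Adj v u
    irrefl  : ∀ {v} → ¬ Adj v v
open Graph public

data Reach {n : ℕ} (G : Graph n) (A : Subset n) : Fin n → Fin n → Set where
  here : ∀ {u} → u ∈ A → Reach G A u u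
  step : ∀ {u w v} → Reach G A u w → Adj G w v → v ∈ A → Reach G A u v

InducedConnected : ∀ {n} → Graph n → Subset n → Set
InducedConnected G A =
  Nonempty A × (∀ {u v} → u ∈ A → v ∈ A → Reach G A u v)

part : ∀ {n m} → (Fin n → Fin m) → Fin m → Subset n
part f i = tabulate (λ v → ⌊ f v ≟ i ⌋)

IntPartition : ℕ → (m : ℕ) → Vec ℕ m → Set
IntPartition n m a = (∀ i → 1 ≤ lookup a i) × sum a Eq.≡ n

AP : ∀ {n} → Graph n → Set
AP {n} G =
  ∀ (m : ℕ) (a : Vec ℕ m) → IntPartition n m a →
  Σ (Fin n → Fin m) λ f →
    ∀ i → (∣ part f i ∣ Eq.≡ lookup a i) × InducedConnected G (part f i)

-- Cs (a list of p vertex sets) is exactly the family of connected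
-- components of G − S: the Cs partition V(G) ∖ S into nonempty sets,
-- each inducing a connected subgraph, with no edges between distinct sets.
IsComponentsOf : ∀ {n} → Graph n → Subset n → (p : ℕ) → Vec (Subset n) p → Set
IsComponentsOf {n} G S p Cs =
    (∀ v → v ∉ S → Σ (Fin p) λ i → v ∈ lookup Cs i)
  × (∀ v i → v ∈ lookup Cs i → v ∉ S)
  × (∀ i j v → v ∈ lookup Cs i → v ∈ lookup Cs j → i Eq.≡ j)
  × (∀ i → InducedConnected G (lookup Cs i))
  × (∀ i j u v → u ∈ lookup Cs i → v ∈ lookup Cs j → Adj G u v → i Eq.≡ j)

-- (k-1) · w_k(G,S) = Σ_C |V(C)|_k, computed from the component family Cs.
scaledW : ∀ {p n} (k : ℕ) .{{_ : NonZero k}} → Vec (Subset n) p → ℕ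
scaledW k Cs = sum (map (λ C → ∣ C ∣ % k) Cs)

{-# OPTIONS --safe #-}

-- Partition V(G) into ⌊n/k⌋ connected parts of size k and n mod k singletons.  A part of size k
-- missing S is connected in G − S, so it lies inside a single component; hence |C| mod k is at
-- most the number of vertices C receives from the remaining parts.  Such a part of size k meets S,
-- so has at most (k − 1)|P ∩ S| vertices outside S, and the singletons add at most n mod k.

module Submission where

open import Defs
open import Data.Nat using (ℕ; _+_; _*_; _%_; _≤_; _∸_; NonZero)
open import Data.Fin.Subset using (Subset; ∣_∣)
open import Data.Vec using (Vec)

open import Data.Nat using (zero; suc; z≤n; _/_; _≟_)
open import Data.Nat.Properties
open import Data.Nat.DivMod using (m≡m%n+[m/n]*n; [m+kn]%n≡m%n; m%n≤m; %-remove-+ˡ)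
open import Data.Nat.Divisibility using (_∣_; _∣0; ∣-reflexive)
open import Data.Fin using (Fin; zero; suc; punchIn)
import Data.Fin.Properties as Fin
open import Data.Fin.Subset using (_∈_; _∉_; _⊆_; _∩_; ∁; ⊤; Empty; inside; outside)
open import Data.Fin.Subset.Properties
  using (_∈?_; x∈p∩q⁺; x∈p∩q⁻; p∩q⊆q; ⊆-antisym; nonempty?; Empty-unique; ∣⊥∣≡0;
         x∈p⇒∣p-x∣<∣p∣; x∈∁p⇒x∉p; x∉p⇒x∈∁p; ∩-comm; ∩-identityˡ; ⊆⊤)
open import Data.Vec as Vec using ([]; _∷_; lookup; replicate; _++_)
open import Data.Vec.Properties using (lookup∘tabulate; []=⇒lookup; lookup⇒[]=; lookup-replicate; map-++; map-replicate; sum-++)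
open import Data.Vec.Relation.Unary.All using (All)
open import Data.Vec.Relation.Unary.All.Properties using (lookup⁺; lookup⁻; ++⁺)
open import Data.Bool using (if_then_else_)
open import Data.Product using (Σ; ∃; _×_; _,_; proj₁; proj₂)
open import Data.Sum using (_⊎_; inj₁; inj₂)
open import Function using (_∘_)
open import Relation.Nullary using (¬_; Dec; yes; no; does; ¬?; _×-dec_; contradiction)
open import Relation.Nullary.Decidable using (⌊_⌋; isYes≗does; dec-true; dec-false)
open import Relation.Unary using (Decidable)
open import Relation.Binary.PropositionalEquality hiding (sym)
import Relation.Binary.PropositionalEquality as ≡
open import Algebra.Properties.Semiring.Sum +-*-semiring
  using (sum; sum-syntax; sum-cong-≗; sum-replicate-zero; sum-remove; ∑-comm; ∑-distrib-+; *-distribˡ-sum; *-distribʳ-sum)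

𝟙[_] : ∀ {a} {A : Set a} → Dec A → ℕ
𝟙[ a? ] = if does a? then 1 else 0

𝟙-yes : ∀ {a} {A : Set a} (a? : Dec A) → A → 𝟙[ a? ] ≡ 1
𝟙-yes a? a = cong (if_then 1 else 0) (dec-true a? a)

𝟙-no : ∀ {a} {A : Set a} (a? : Dec A) → ¬ A → 𝟙[ a? ] ≡ 0
𝟙-no a? ¬a = cong (if_then 1 else 0) (dec-false a? ¬a)

sum-mono-≤ : ∀ {m} {f g : Fin m → ℕ} → (∀ i → f i ≤ g i) → sum f ≤ sum g
sum-mono-≤ {zero}  _   = z≤n
sum-mono-≤ {suc m} f≤g = +-mono-≤ (f≤g zero) (sum-mono-≤ (f≤g ∘ suc))

sum-zero : ∀ {m} {f : Fin m → ℕ} → (∀ i → f i ≡ 0) → sum f ≡ 0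
sum-zero {m} f≡0 = trans (sum-cong-≗ f≡0) (sum-replicate-zero m)

sum-single : ∀ {m} (f : Fin m → ℕ) i → (∀ j → j ≢ i → f j ≡ 0) → sum f ≡ f i
sum-single {suc m} f i f≡0 = begin
  sum f                          ≡⟨ sum-remove f ⟩
  f i + sum (f ∘ punchIn i)      ≡⟨ cong (f i +_) (sum-zero (λ j → f≡0 _ (Fin.punchInᵢ≢i i j))) ⟩
  f i + 0                        ≡⟨ +-identityʳ (f i) ⟩
  f i                            ∎
  where open ≡-Reasoning

sum-map-lookup : ∀ {a} {A : Set a} {m} (h : A → ℕ) (xs : Vec A m) →
                 Vec.sum (Vec.map h xs) ≡ sum (h ∘ lookup xs)
sum-map-lookup h []       = refl
sum-map-lookup h (x ∷ xs) = cong (h x +_) (sum-map-lookup h xs)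

sum-replicate : ∀ m x → Vec.sum (replicate m x) ≡ m * x
sum-replicate zero    x = refl
sum-replicate (suc m) x = cong (x +_) (sum-replicate m x)

[m+n]%d≤m+n%d : ∀ m n d .{{_ : NonZero d}} → (m + n) % d ≤ m + n % d
[m+n]%d≤m+n%d m n d = begin
  (m + n) % d                      ≡⟨ cong (λ t → (m + t) % d) (m≡m%n+[m/n]*n n d) ⟩
  (m + (n % d + (n / d) * d)) % d  ≡⟨ cong (_% d) (≡.sym (+-assoc m (n % d) _)) ⟩
  (m + n % d + (n / d) * d) % d    ≡⟨ [m+kn]%n≡m%n (m + n % d) (n / d) d ⟩
  (m + n % d) % d                  ≤⟨ m%n≤m (m + n % d) d ⟩
  m + n % d                        ∎
  where open ≤-Reasoning

sum%≤sum-without-divisible : ∀ {m} k .{{_ : NonZero k}} {P : Fin m → Set} (P? : Decidable P)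
                             (x : Fin m → ℕ) → (∀ j → P j → k ∣ x j) →
                             sum x % k ≤ ∑[ j < m ] (𝟙[ ¬? (P? j) ] * x j)
sum%≤sum-without-divisible {zero}  k P? x P⇒k∣ = m%n≤m 0 k
sum%≤sum-without-divisible {suc m} k P? x P⇒k∣ with P? zero
... | yes P0 = begin
  (x zero + sum (x ∘ suc)) % k  ≡⟨ %-remove-+ˡ (sum (x ∘ suc)) (P⇒k∣ zero P0) ⟩
  sum (x ∘ suc) % k             ≤⟨ sum%≤sum-without-divisible k (P? ∘ suc) (x ∘ suc) (P⇒k∣ ∘ suc) ⟩
  ∑[ j < m ] (𝟙[ ¬? (P? (suc j)) ] * x (suc j))  ∎
  where open ≤-Reasoning
... | no _ = begin
  (x zero + sum (x ∘ suc)) % k  ≤⟨ [m+n]%d≤m+n%d (x zero) (sum (x ∘ suc)) k ⟩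
  x zero + sum (x ∘ suc) % k    ≤⟨ +-mono-≤ (≤-reflexive (≡.sym (*-identityˡ (x zero))))
                                             (sum%≤sum-without-divisible k (P? ∘ suc) (x ∘ suc) (P⇒k∣ ∘ suc)) ⟩
  1 * x zero + ∑[ j < m ] (𝟙[ ¬? (P? (suc j)) ] * x (suc j))  ∎
  where open ≤-Reasoning

∣p∣≡∑𝟙 : ∀ {n} (p : Subset n) → ∣ p ∣ ≡ ∑[ v < n ] 𝟙[ v ∈? p ]
∣p∣≡∑𝟙 []            = refl
∣p∣≡∑𝟙 (inside ∷ p)  = cong suc (∣p∣≡∑𝟙 p)
∣p∣≡∑𝟙 (outside ∷ p) = ∣p∣≡∑𝟙 p

𝟙-∩ : ∀ {n} (p q : Subset n) v → 𝟙[ v ∈? p ∩ q ] ≡ 𝟙[ v ∈? p ] * 𝟙[ v ∈? q ]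
𝟙-∩ p q v with v ∈? p | v ∈? q | v ∈? p ∩ q
... | yes _   | yes _   | yes _   = refl
... | yes v∈p | yes v∈q | no v∉p∩q = contradiction (x∈p∩q⁺ (v∈p , v∈q)) v∉p∩q
... | no v∉p  | _       | yes v∈p∩q = contradiction (proj₁ (x∈p∩q⁻ p q v∈p∩q)) v∉p
... | yes _   | no v∉q  | yes v∈p∩q = contradiction (proj₂ (x∈p∩q⁻ p q v∈p∩q)) v∉q
... | no _    | _       | no _     = refl
... | yes _   | no _    | no _     = refl

∣∁q∩p∣+∣q∩p∣≡∣p∣ : ∀ {n} (q p : Subset n) → ∣ ∁ q ∩ p ∣ + ∣ q ∩ p ∣ ≡ ∣ p ∣
∣∁q∩p∣+∣q∩p∣≡∣p∣ []            []            = refl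
∣∁q∩p∣+∣q∩p∣≡∣p∣ (outside ∷ q) (outside ∷ p) = ∣∁q∩p∣+∣q∩p∣≡∣p∣ q p
∣∁q∩p∣+∣q∩p∣≡∣p∣ (inside ∷ q)  (outside ∷ p) = ∣∁q∩p∣+∣q∩p∣≡∣p∣ q p
∣∁q∩p∣+∣q∩p∣≡∣p∣ (outside ∷ q) (inside ∷ p)  = cong suc (∣∁q∩p∣+∣q∩p∣≡∣p∣ q p)
∣∁q∩p∣+∣q∩p∣≡∣p∣ (inside ∷ q)  (inside ∷ p)  =
  trans (+-suc ∣ ∁ q ∩ p ∣ ∣ q ∩ p ∣) (cong suc (∣∁q∩p∣+∣q∩p∣≡∣p∣ q p))

∣p∣≡0⇒Empty : ∀ {n} {p : Subset n} → ∣ p ∣ ≡ 0 → Empty p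
∣p∣≡0⇒Empty ∣p∣≡0 (x , x∈p) = <⇒≢ (≤-<-trans z≤n (x∈p⇒∣p-x∣<∣p∣ x∈p)) (≡.sym ∣p∣≡0)

∣q∩p∣≡∣p∣ : ∀ {n} {p q : Subset n} → p ⊆ q → ∣ q ∩ p ∣ ≡ ∣ p ∣
∣q∩p∣≡∣p∣ {p = p} {q} p⊆q =
  cong ∣_∣ (⊆-antisym (p∩q⊆q q p) (λ x∈p → x∈p∩q⁺ (p⊆q x∈p , x∈p)))

record IsPartition {m n} (P : Fin m → Subset n) (A : Subset n) : Set where
  field
    cover    : ∀ {v} → v ∈ A → ∃ λ i → v ∈ P i
    ⊆-whole  : ∀ i → P i ⊆ A
    disjoint : ∀ {i j v} → v ∈ P i → v ∈ P j → i ≡ j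

module _ {m n} {P : Fin m → Subset n} {A : Subset n} (partition : IsPartition P A) where
  open IsPartition partition

  ∑𝟙-partition : ∀ v → ∑[ i < m ] 𝟙[ v ∈? P i ] ≡ 𝟙[ v ∈? A ]
  ∑𝟙-partition v with v ∈? A
  ... | no v∉A = sum-zero (λ i → 𝟙-no (v ∈? P i) (v∉A ∘ ⊆-whole i))
  ... | yes v∈A with cover v∈A
  ... | i , v∈Pi = trans (sum-single _ i others) (𝟙-yes (v ∈? P i) v∈Pi)
    where
    others : ∀ j → j ≢ i → 𝟙[ v ∈? P j ] ≡ 0
    others j j≢i = 𝟙-no (v ∈? P j) (j≢i ∘ λ v∈Pj → disjoint v∈Pj v∈Pi)

  ∑∣∩∣-partition : ∀ B → ∑[ i < m ] ∣ P i ∩ B ∣ ≡ ∣ A ∩ B ∣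
  ∑∣∩∣-partition B = begin
    ∑[ i < m ] ∣ P i ∩ B ∣                              ≡⟨ sum-cong-≗ (λ i → ∣p∣≡∑𝟙 (P i ∩ B)) ⟩
    ∑[ i < m ] ∑[ v < n ] 𝟙[ v ∈? P i ∩ B ]             ≡⟨ ∑-comm (λ i v → 𝟙[ v ∈? P i ∩ B ]) ⟩
    ∑[ v < n ] ∑[ i < m ] 𝟙[ v ∈? P i ∩ B ]             ≡⟨ sum-cong-≗ (λ v → sum-cong-≗ (λ i → 𝟙-∩ (P i) B v)) ⟩
    ∑[ v < n ] ∑[ i < m ] (𝟙[ v ∈? P i ] * 𝟙[ v ∈? B ]) ≡⟨ sum-cong-≗ (λ v → ≡.sym (*-distribʳ-sum 𝟙[ v ∈? B ] (λ i → 𝟙[ v ∈? P i ]))) ⟩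
    ∑[ v < n ] (∑[ i < m ] 𝟙[ v ∈? P i ] * 𝟙[ v ∈? B ]) ≡⟨ sum-cong-≗ (λ v → cong (_* 𝟙[ v ∈? B ]) (∑𝟙-partition v)) ⟩
    ∑[ v < n ] (𝟙[ v ∈? A ] * 𝟙[ v ∈? B ])              ≡⟨ sum-cong-≗ (λ v → ≡.sym (𝟙-∩ A B v)) ⟩
    ∑[ v < n ] 𝟙[ v ∈? A ∩ B ]                          ≡⟨ ≡.sym (∣p∣≡∑𝟙 (A ∩ B)) ⟩
    ∣ A ∩ B ∣                                           ∎
    where open ≡-Reasoning

module _ {n m} (f : Fin n → Fin m) where

  ∈-part⁺ : ∀ v → v ∈ part f (f v)
  ∈-part⁺ v = lookup⇒[]= v (part f (f v))
    (trans (lookup∘tabulate (λ u → ⌊ f u Fin.≟ f v ⌋) v)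
           (trans (isYes≗does (f v Fin.≟ f v)) (dec-true (f v Fin.≟ f v) refl)))

  ∈-part⁻ : ∀ {v i} → v ∈ part f i → f v ≡ i
  ∈-part⁻ {v} {i} v∈Pi
    with f v Fin.≟ i | trans (≡.sym (lookup∘tabulate (λ u → ⌊ f u Fin.≟ i ⌋) v)) ([]=⇒lookup v∈Pi)
  ... | yes fv≡i | _  = fv≡i
  ... | no _     | ()

  part-partition : IsPartition (part f) ⊤
  part-partition = record
    { cover    = λ {v} _ → f v , ∈-part⁺ v
    ; ⊆-whole  = λ _ → ⊆⊤
    ; disjoint = λ v∈Pi v∈Pj → trans (≡.sym (∈-part⁻ v∈Pi)) (∈-part⁻ v∈Pj)
    }

module _ {n p} {G : Graph n} {S : Subset n} {Cs : Vec (Subset n) p}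
         (components : IsComponentsOf G S p Cs) where
  private
    covers : ∀ v → v ∉ S → Σ (Fin p) λ i → v ∈ lookup Cs i
    covers = proj₁ components

    avoids : ∀ v i → v ∈ lookup Cs i → v ∉ S
    avoids = proj₁ (proj₂ components)

    disjoint : ∀ i j v → v ∈ lookup Cs i → v ∈ lookup Cs j → i ≡ j
    disjoint = proj₁ (proj₂ (proj₂ components))

    no-edges : ∀ i j u v → u ∈ lookup Cs i → v ∈ lookup Cs j → Adj G u v → i ≡ j
    no-edges = proj₂ (proj₂ (proj₂ (proj₂ components)))

  components-partition : IsPartition (lookup Cs) (∁ S)
  components-partition = record
    { cover    = λ {v} v∈∁S → covers v (x∈∁p⇒x∉p v∈∁S)
    ; ⊆-whole  = λ i {v} v∈Ci → x∉p⇒x∈∁p (avoids v i v∈Ci)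
    ; disjoint = λ {i} {j} {v} → disjoint i j v
    }

  Reach-preserves-component : ∀ {A u v} i → (∀ {w} → w ∈ A → w ∉ S) →
                              Reach G A u v → u ∈ lookup Cs i → v ∈ lookup Cs i
  Reach-preserves-component i A⊆∁S (here _) u∈Ci = u∈Ci
  Reach-preserves-component i A⊆∁S (step {w = w} {v = v} u⇝w w~v v∈A) u∈Ci
    with covers v (A⊆∁S v∈A)
  ... | j , v∈Cj = subst (λ t → v ∈ lookup Cs t) (≡.sym i≡j) v∈Cj
    where
    i≡j : i ≡ j
    i≡j = no-edges i j w v (Reach-preserves-component i A⊆∁S u⇝w u∈Ci) v∈Cj w~v

  connected-disjoint-or-⊆-component : ∀ {P} → InducedConnected G P → (∀ {w} → w ∈ P → w ∉ S) →
                                      ∀ i → Empty (lookup Cs i ∩ P) ⊎ P ⊆ lookup Cs i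
  connected-disjoint-or-⊆-component {P} (_ , reach) P⊆∁S i with nonempty? (lookup Cs i ∩ P)
  ... | no empty = inj₁ empty
  ... | yes (v , v∈Ci∩P) with x∈p∩q⁻ (lookup Cs i) P v∈Ci∩P
  ... | v∈Ci , v∈P = inj₂ λ u∈P → Reach-preserves-component i P⊆∁S (reach v∈P u∈P) v∈Ci

offSize : ℕ → ℕ → ℕ
offSize k a = 𝟙[ ¬? (a ≟ k) ] * a

offSize-≢ : ∀ {k a} → a ≢ k → offSize k a ≡ a
offSize-≢ {k} {a} a≢k = trans (cong (_* a) (𝟙-yes (¬? (a ≟ k)) a≢k)) (*-identityˡ a)

offSize-≡ : ∀ k → offSize k k ≡ 0
offSize-≡ k = cong (_* k) (𝟙-no (¬? (k ≟ k)) (λ k≢k → k≢k refl))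

bad-part-bound : ∀ k {a y z} → y + z ≡ a → (good? : Dec (a ≡ k × z ≡ 0)) →
                 𝟙[ ¬? good? ] * y ≤ (k ∸ 1) * z + offSize k a
bad-part-bound k y+z≡a (yes _) = z≤n
bad-part-bound k {a} {y} {z} y+z≡a (no bad) with a ≟ k
... | no a≢k = begin
  1 * y                      ≡⟨ *-identityˡ y ⟩
  y                          ≤⟨ m≤m+n y z ⟩
  y + z                      ≡⟨ y+z≡a ⟩
  a                          ≤⟨ m≤n+m a ((k ∸ 1) * z) ⟩
  (k ∸ 1) * z + a            ≡⟨ cong ((k ∸ 1) * z +_) (≡.sym (offSize-≢ a≢k)) ⟩
  (k ∸ 1) * z + offSize k a  ∎
  where open ≤-Reasoning
... | yes refl with z
...   | zero   = contradiction (refl , refl) bad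
...   | suc z′ = begin
  1 * y                          ≡⟨ *-identityˡ y ⟩
  y                              ≤⟨ m≤m+n y z′ ⟩
  y + z′                         ≡⟨ cong (_∸ 1) (trans (≡.sym (+-suc y z′)) y+z≡a) ⟩
  a ∸ 1                          ≤⟨ m≤m*n (a ∸ 1) (suc z′) ⟩
  (a ∸ 1) * suc z′               ≡⟨ ≡.sym (+-identityʳ _) ⟩
  (a ∸ 1) * suc z′ + 0           ≡⟨ cong ((a ∸ 1) * suc z′ +_) (≡.sym (offSize-≡ a)) ⟩
  (a ∸ 1) * suc z′ + offSize a a ∎
  where open ≤-Reasoning

IsConnectedPartition : ∀ {n m} → Graph n → Vec ℕ m → (Fin n → Fin m) → Set
IsConnectedPartition G a f = ∀ j → ∣ part f j ∣ ≡ lookup a j × InducedConnected G (part f j)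

module _ {n p m} {G : Graph n} {S : Subset n} {Cs : Vec (Subset n) p} {a : Vec ℕ m} {f : Fin n → Fin m}
         (components : IsComponentsOf G S p Cs) (parts : IsConnectedPartition G a f)
         (k : ℕ) .{{_ : NonZero k}} where
  private
    P : Fin m → Subset n
    P = part f

    C : Fin p → Subset n
    C = lookup Cs

    Good : Fin m → Set
    Good j = lookup a j ≡ k × ∣ S ∩ P j ∣ ≡ 0

    good? : Decidable Good
    good? j = lookup a j ≟ k ×-dec ∣ S ∩ P j ∣ ≟ 0

    bad : Fin m → ℕ
    bad j = 𝟙[ ¬? (good? j) ]

  good-part-divides : ∀ {j} → Good j → ∀ i → k ∣ ∣ C i ∩ P j ∣
  good-part-divides {j} (aj≡k , ∣S∩Pj∣≡0) i
    with connected-disjoint-or-⊆-component {Cs = Cs} components (proj₂ (parts j)) Pj⊆∁S i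
    where
    Pj⊆∁S : ∀ {w} → w ∈ P j → w ∉ S
    Pj⊆∁S w∈Pj w∈S = ∣p∣≡0⇒Empty ∣S∩Pj∣≡0 (_ , x∈p∩q⁺ (w∈S , w∈Pj))
  ... | inj₁ empty = subst (k ∣_) (≡.sym (trans (cong ∣_∣ (Empty-unique empty)) (∣⊥∣≡0 n))) (k ∣0)
  ... | inj₂ Pj⊆Ci = ∣-reflexive (≡.sym (trans (∣q∩p∣≡∣p∣ Pj⊆Ci) (trans (proj₁ (parts j)) aj≡k)))

  component-residue-≤ : ∀ i → ∣ C i ∣ % k ≤ ∑[ j < m ] (bad j * ∣ C i ∩ P j ∣)
  component-residue-≤ i = begin
    ∣ C i ∣ % k                  ≡⟨ cong (_% k) split ⟩
    ∑[ j < m ] ∣ C i ∩ P j ∣ % k ≤⟨ sum%≤sum-without-divisible k good? _ (λ j good → good-part-divides good i) ⟩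
    ∑[ j < m ] (bad j * ∣ C i ∩ P j ∣) ∎
    where
    open ≤-Reasoning
    split : ∣ C i ∣ ≡ ∑[ j < m ] ∣ C i ∩ P j ∣
    split = ≡.sym (begin-equality
      ∑[ j < m ] ∣ C i ∩ P j ∣ ≡⟨ sum-cong-≗ (λ j → cong ∣_∣ (∩-comm (C i) (P j))) ⟩
      ∑[ j < m ] ∣ P j ∩ C i ∣ ≡⟨ ∑∣∩∣-partition (part-partition f) (C i) ⟩
      ∣ ⊤ ∩ C i ∣             ≡⟨ cong ∣_∣ (∩-identityˡ (C i)) ⟩
      ∣ C i ∣                 ∎)

  bad-part-≤ : ∀ j → bad j * ∣ ∁ S ∩ P j ∣ ≤ (k ∸ 1) * ∣ S ∩ P j ∣ + offSize k (lookup a j)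
  bad-part-≤ j = bad-part-bound k (trans (∣∁q∩p∣+∣q∩p∣≡∣p∣ S (P j)) (proj₁ (parts j))) (good? j)

  scaledW-≤ : scaledW k Cs ≤ (k ∸ 1) * ∣ S ∣ + Vec.sum (Vec.map (offSize k) a)
  scaledW-≤ = begin
    scaledW k Cs                                                 ≡⟨ sum-map-lookup (λ D → ∣ D ∣ % k) Cs ⟩
    ∑[ i < p ] (∣ C i ∣ % k)                                     ≤⟨ sum-mono-≤ component-residue-≤ ⟩
    ∑[ i < p ] ∑[ j < m ] (bad j * ∣ C i ∩ P j ∣)                ≡⟨ ∑-comm (λ i j → bad j * ∣ C i ∩ P j ∣) ⟩
    ∑[ j < m ] ∑[ i < p ] (bad j * ∣ C i ∩ P j ∣)                ≡⟨ sum-cong-≗ (λ j → ≡.sym (*-distribˡ-sum (bad j) (λ i → ∣ C i ∩ P j ∣))) ⟩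
    ∑[ j < m ] (bad j * ∑[ i < p ] ∣ C i ∩ P j ∣)                ≡⟨ sum-cong-≗ (λ j → cong (bad j *_) (∑∣∩∣-partition (components-partition {Cs = Cs} components) (P j))) ⟩
    ∑[ j < m ] (bad j * ∣ ∁ S ∩ P j ∣)                           ≤⟨ sum-mono-≤ bad-part-≤ ⟩
    ∑[ j < m ] ((k ∸ 1) * ∣ S ∩ P j ∣ + offSize k (lookup a j))  ≡⟨ ∑-distrib-+ (λ j → (k ∸ 1) * ∣ S ∩ P j ∣) (λ j → offSize k (lookup a j)) ⟩
    ∑[ j < m ] ((k ∸ 1) * ∣ S ∩ P j ∣) + ∑[ j < m ] offSize k (lookup a j)
                                                                 ≡⟨ cong₂ _+_ S-split (≡.sym (sum-map-lookup (offSize k) a)) ⟩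
    (k ∸ 1) * ∣ S ∣ + Vec.sum (Vec.map (offSize k) a)            ∎
    where
    open ≤-Reasoning
    S-split : ∑[ j < m ] ((k ∸ 1) * ∣ S ∩ P j ∣) ≡ (k ∸ 1) * ∣ S ∣
    S-split = begin-equality
      ∑[ j < m ] ((k ∸ 1) * ∣ S ∩ P j ∣) ≡⟨ ≡.sym (*-distribˡ-sum (k ∸ 1) (λ j → ∣ S ∩ P j ∣)) ⟩
      (k ∸ 1) * ∑[ j < m ] ∣ S ∩ P j ∣   ≡⟨ cong ((k ∸ 1) *_) (sum-cong-≗ (λ j → cong ∣_∣ (∩-comm S (P j)))) ⟩
      (k ∸ 1) * ∑[ j < m ] ∣ P j ∩ S ∣   ≡⟨ cong ((k ∸ 1) *_) (∑∣∩∣-partition (part-partition f) S) ⟩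
      (k ∸ 1) * ∣ ⊤ ∩ S ∣               ≡⟨ cong (λ t → (k ∸ 1) * ∣ t ∣) (∩-identityˡ S) ⟩
      (k ∸ 1) * ∣ S ∣                   ∎

replicate-++-IntPartition : ∀ {k} → 1 ≤ k → ∀ q r →
                            IntPartition (q * k + r) (q + r) (replicate q k ++ replicate r 1)
replicate-++-IntPartition {k} 1≤k q r = positive , total
  where
  all-replicate : ∀ {x} m → 1 ≤ x → All (1 ≤_) (replicate m x)
  all-replicate {x} m 1≤x = lookup⁻ (λ i → subst (1 ≤_) (≡.sym (lookup-replicate i x)) 1≤x)
  positive : ∀ i → 1 ≤ lookup (replicate q k ++ replicate r 1) i
  positive = lookup⁺ (++⁺ (all-replicate q 1≤k) (all-replicate r ≤-refl))
  total : Vec.sum (replicate q k ++ replicate r 1) ≡ q * k + r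
  total = begin
    Vec.sum (replicate q k ++ replicate r 1)            ≡⟨ sum-++ (replicate q k) ⟩
    Vec.sum (replicate q k) + Vec.sum (replicate r 1)   ≡⟨ cong₂ _+_ (sum-replicate q k) (sum-replicate r 1) ⟩
    q * k + r * 1                                       ≡⟨ cong (q * k +_) (*-identityʳ r) ⟩
    q * k + r                                           ∎
    where open ≡-Reasoning

sum-offSize-replicate-++ : ∀ {k} → 2 ≤ k → ∀ q r →
                           Vec.sum (Vec.map (offSize k) (replicate q k ++ replicate r 1)) ≡ r
sum-offSize-replicate-++ {k} 2≤k q r = begin
  Vec.sum (Vec.map (offSize k) (replicate q k ++ replicate r 1))
    ≡⟨ cong Vec.sum (map-++ (offSize k) (replicate q k) (replicate r 1)) ⟩
  Vec.sum (Vec.map (offSize k) (replicate q k) ++ Vec.map (offSize k) (replicate r 1))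
    ≡⟨ sum-++ (Vec.map (offSize k) (replicate q k)) ⟩
  Vec.sum (Vec.map (offSize k) (replicate q k)) + Vec.sum (Vec.map (offSize k) (replicate r 1))
    ≡⟨ cong₂ (λ xs ys → Vec.sum xs + Vec.sum ys) (map-replicate (offSize k) k q) (map-replicate (offSize k) 1 r) ⟩
  Vec.sum (replicate q (offSize k k)) + Vec.sum (replicate r (offSize k 1))
    ≡⟨ cong₂ _+_ (sum-replicate q (offSize k k)) (sum-replicate r (offSize k 1)) ⟩
  q * offSize k k + r * offSize k 1
    ≡⟨ cong₂ (λ x y → q * x + r * y) (offSize-≡ k) (offSize-≢ (<⇒≢ 2≤k)) ⟩
  q * 0 + r * 1
    ≡⟨ cong₂ _+_ (*-zeroʳ q) (*-identityʳ r) ⟩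
  r ∎
  where open ≡-Reasoning

corollary30 : ∀ {n} (G : Graph n) → AP G → (S : Subset n) →
    (k : ℕ) → 2 ≤ k → .{{_ : NonZero k}} →
    (p : ℕ) (Cs : Vec (Subset n) p) → IsComponentsOf G S p Cs →
    scaledW k Cs ≤ (k ∸ 1) * ∣ S ∣ + n % k
corollary30 {n} G ap S k 2≤k p Cs components =
  subst (λ t → scaledW k Cs ≤ (k ∸ 1) * ∣ S ∣ + t) (sum-offSize-replicate-++ 2≤k q r)
        (scaledW-≤ {Cs = Cs} {a = parts} components (proj₂ partition) k)
  where
  q r : ℕ
  q = n / k
  r = n % k
  parts : Vec ℕ (q + r)
  parts = replicate q k ++ replicate r 1
  q*k+r≡n : q * k + r ≡ n
  q*k+r≡n = trans (+-comm (q * k) r) (≡.sym (m≡m%n+[m/n]*n n k))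
  partition : Σ (Fin n → Fin (q + r)) (IsConnectedPartition G parts)
  partition = ap (q + r) parts
    (subst (λ t → IntPartition t (q + r) parts) q*k+r≡n
           (replicate-++-IntPartition (<⇒≤ 2≤k) q r))
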